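{- Let $S$ be a consistent extension of $\mathsf{Succ}^{ - }$ in the same language. Then for any $X\subseteq\mathbb{N}$, $X$ is weakly representable in $S$ if and only if $X$ is finite or co-finite.
   Context: $\mathsf{Succ}^{ - }$ is the theory in the language $\{\mathbf{0},\mathbf{S}\}$ with axioms $\forall x\forall y(\mathbf{S}x=\mathbf{S}y\to x=y)$, $\forall x(\mathbf{S}x\ne\mathbf{0})$, $\forall x(x\ne\mathbf{0}\to\exists y(x=\mathbf{S}y))$. With $\overline{n}=\mathbf{S}^n\mathbf{0}$, a set $X\subseteq\mathbb{N}$ is weakly representable in $S$ if there is a formula $\phi(x)$ such that for all $n$, $n\in X\iff S\vdash\phi(\overline{n})$. -}

module Defs where

open import Data.Nat using (ℕ; zero; suc; _<_)
open import Data.List using (List; []; _∷_; map)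
open import Data.List.Membership.Propositional using (_∈_)
open import Data.List.Relation.Unary.All using (All)
open import Data.Product using (Σ; ∃; _×_; _,_)
open import Data.Empty using (⊥)
open import Relation.Nullary using (¬_)

-- Syntax of first-order logic with equality in the language {0, S}.
-- Variables are de Bruijn indices.

data Term : Set where
  var  : ℕ → Term
  𝟎    : Term
  𝐒    : Term → Term

infixr 5 _⇒_
infixr 6 _∨_
infixr 7 _∧_
infix  8 _≐_

data Formula : Set where
  ⊥'   : Formula
  _≐_  : Term → Term → Formula
  _⇒_  : Formula → Formula → Formula
  _∧_  : Formula → Formula → Formula
  _∨_  : Formula → Formula → Formula
  ∀'   : Formula → Formula
  ∃'   : Formula → Formula

¬' : Formula → Formula
¬' φ = φ ⇒ ⊥'

renT : (ℕ → ℕ) → Term → Term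
renT ρ (var i) = var (ρ i)
renT ρ 𝟎       = 𝟎
renT ρ (𝐒 t)   = 𝐒 (renT ρ t)

substT : (ℕ → Term) → Term → Term
substT σ (var i) = σ i
substT σ 𝟎       = 𝟎
substT σ (𝐒 t)   = 𝐒 (substT σ t)

lift : (ℕ → Term) → ℕ → Term
lift σ zero    = var zero
lift σ (suc i) = renT suc (σ i)

subst : (ℕ → Term) → Formula → Formula
subst σ ⊥'      = ⊥'
subst σ (s ≐ t) = substT σ s ≐ substT σ t
subst σ (φ ⇒ ψ) = subst σ φ ⇒ subst σ ψ
subst σ (φ ∧ ψ) = subst σ φ ∧ subst σ ψ
subst σ (φ ∨ ψ) = subst σ φ ∨ subst σ ψ
subst σ (∀' φ)  = ∀' (subst (lift σ) φ)
subst σ (∃' φ)  = ∃' (subst (lift σ) φ)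

single : Term → ℕ → Term
single t zero    = t
single t (suc i) = var i

_[_] : Formula → Term → Formula
φ [ t ] = subst (single t) φ

shift : Formula → Formula
shift = subst (λ i → var (suc i))

data WFT (n : ℕ) : Term → Set where
  var : ∀ {i} → i < n → WFT n (var i)
  𝟎   : WFT n 𝟎
  𝐒   : ∀ {t} → WFT n t → WFT n (𝐒 t)

data WF : ℕ → Formula → Set where
  ⊥'  : ∀ {n} → WF n ⊥'
  _≐_ : ∀ {n s t} → WFT n s → WFT n t → WF n (s ≐ t)
  _⇒_ : ∀ {n φ ψ} → WF n φ → WF n ψ → WF n (φ ⇒ ψ)
  _∧_ : ∀ {n φ ψ} → WF n φ → WF n ψ → WF n (φ ∧ ψ)
  _∨_ : ∀ {n φ ψ} → WF n φ → WF n ψ → WF n (φ ∨ ψ)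
  ∀'  : ∀ {n φ} → WF (suc n) φ → WF n (∀' φ)
  ∃'  : ∀ {n φ} → WF (suc n) φ → WF n (∃' φ)

Sentence : Formula → Set
Sentence = WF 0

infix 3 _⊢_

data _⊢_ (Γ : List Formula) : Formula → Set where
  assum : ∀ {φ} → φ ∈ Γ → Γ ⊢ φ
  ⇒I    : ∀ {φ ψ} → (φ ∷ Γ) ⊢ ψ → Γ ⊢ φ ⇒ ψ
  ⇒E    : ∀ {φ ψ} → Γ ⊢ φ ⇒ ψ → Γ ⊢ φ → Γ ⊢ ψ
  ∧I    : ∀ {φ ψ} → Γ ⊢ φ → Γ ⊢ ψ → Γ ⊢ φ ∧ ψ
  ∧E₁   : ∀ {φ ψ} → Γ ⊢ φ ∧ ψ → Γ ⊢ φ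
  ∧E₂   : ∀ {φ ψ} → Γ ⊢ φ ∧ ψ → Γ ⊢ ψ
  ∨I₁   : ∀ {φ ψ} → Γ ⊢ φ → Γ ⊢ φ ∨ ψ
  ∨I₂   : ∀ {φ ψ} → Γ ⊢ ψ → Γ ⊢ φ ∨ ψ
  ∨E    : ∀ {φ ψ χ} → Γ ⊢ φ ∨ ψ → (φ ∷ Γ) ⊢ χ → (ψ ∷ Γ) ⊢ χ → Γ ⊢ χ
  raa   : ∀ {φ} → (¬' φ ∷ Γ) ⊢ ⊥' → Γ ⊢ φ
  ∀I    : ∀ {φ} → map shift Γ ⊢ φ → Γ ⊢ ∀' φ
  ∀E    : ∀ {φ} (t : Term) → Γ ⊢ ∀' φ → Γ ⊢ φ [ t ]
  ∃I    : ∀ {φ} (t : Term) → Γ ⊢ φ [ t ] → Γ ⊢ ∃' φ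
  ∃E    : ∀ {φ ψ} → Γ ⊢ ∃' φ → (φ ∷ map shift Γ) ⊢ shift ψ → Γ ⊢ ψ
  ≐refl : ∀ (t : Term) → Γ ⊢ t ≐ t
  ≐subst : ∀ {φ s t} → Γ ⊢ s ≐ t → Γ ⊢ φ [ s ] → Γ ⊢ φ [ t ]

Theory : Set₁
Theory = Formula → Set

_⊩_ : Theory → Formula → Set
S ⊩ φ = Σ (List Formula) λ Γ → All S Γ × (Γ ⊢ φ)

IsSentenceTheory : Theory → Set
IsSentenceTheory S = ∀ φ → S φ → Sentence φ

Consistent : Theory → Set
Consistent S = ¬ (S ⊩ ⊥')

succ-ax₁ : Formula
succ-ax₁ = ∀' (∀' (𝐒 (var 1) ≐ 𝐒 (var 0) ⇒ var 1 ≐ var 0))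

succ-ax₂ : Formula
succ-ax₂ = ∀' (¬' (𝐒 (var 0) ≐ 𝟎))

succ-ax₃ : Formula
succ-ax₃ = ∀' (¬' (var 0 ≐ 𝟎) ⇒ ∃' (var 1 ≐ 𝐒 (var 0)))

ExtendsSucc⁻ : Theory → Set
ExtendsSucc⁻ S = (S ⊩ succ-ax₁) × (S ⊩ succ-ax₂) × (S ⊩ succ-ax₃)

num : ℕ → Term
num zero    = 𝟎
num (suc n) = 𝐒 (num n)

WeaklyRepresentable : (ℕ → Set) → Theory → Set
WeaklyRepresentable X S =
  Σ Formula λ φ → WF 1 φ ×
    (∀ n → (X n → S ⊩ (φ [ num n ])) × (S ⊩ (φ [ num n ]) → X n))

Finite : (ℕ → Set) → Set
Finite X = Σ (List ℕ) λ l → ∀ n → (X n → n ∈ l) × (n ∈ l → X n)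

CoFinite : (ℕ → Set) → Set
CoFinite X = Finite (λ n → ¬ X n)

{-# OPTIONS --safe #-}
-- A formula φ(x) of rank r cannot tell two numerals n, m > r apart: from Γ ⊢ φ(n̄) one
-- builds Γ ⊢ φ(m̄), for any Γ proving 𝐒x = 𝐒y → x = y and 𝐒x ≠ 𝟎.  This is a
-- syntactic Ehrenfeucht–Fraïssé argument by induction on φ.  Its free variables are
-- interpreted on the two sides either by numerals a and b, where all such pairs satisfy
-- the same equations a + x = a′ + y for offsets x, y below a budget T, or by a common
-- term provably distinct from all small numerals.  At an existential quantifier the
-- derivation splits on whether the witness is a small numeral; if it is, a numeral with
-- the same offsets from the existing pairs is chosen on the other side, which costs
-- half of the budget.  Hence the set weakly represented by φ contains all n > r or none
-- of them.  Conversely, a finite set is represented by a disjunction of equations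
-- x = k̄, and a co-finite set by the negation of one.
module Submission where

open import Defs
open import Function using (_∘_)
open import Function.Bundles using (_⇔_; mk⇔; module Equivalence)
open import Function.Construct.Symmetry using (⇔-sym)
open import Function.Construct.Composition using (_⇔-∘_)
open import Data.Nat using (ℕ; zero; suc; _+_; _∸_; _≤_; _<_; z≤n; s≤s; _≟_; _⊔_)
open import Data.Nat.Properties
open import Data.List using (List; []; _∷_; map; _++_; filter; upTo)
open import Data.List.Membership.Propositional using (_∈_; _∉_)
open import Data.List.Membership.Propositional.Properties
  using (∈-map⁺; ∈-filter⁺; ∈-filter⁻; ∈-upTo⁺)
open import Data.List.Relation.Unary.Any using (here; there)
open import Data.List.Relation.Binary.Subset.Propositional using (_⊆_)
open import Data.List.Relation.Binary.Subset.Propositional.Properties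
  using (∷⁺ʳ; map⁺; xs⊆xs++ys; xs⊆ys++xs)
open import Data.Product using (_×_; _,_; ∃-syntax; proj₁; proj₂)
open import Data.Sum using (_⊎_; inj₁; inj₂)
open import Data.Empty using (⊥-elim)
open import Data.Unit using (⊤)
open import Data.List.Relation.Unary.All using (All; [])
open import Data.List.Relation.Unary.All.Properties using (++⁺)
open import Relation.Nullary.Decidable using (decidable-stable)
open import Level using (0ℓ)
open import Axiom.ExcludedMiddle using (ExcludedMiddle)
open import Relation.Nullary using (¬_; yes; no)
open import Relation.Binary.PropositionalEquality as ≡
  using (_≡_; _≢_; refl; sym; trans; cong; cong₂; _≗_)

_∘ˢ_ : (ℕ → Term) → (ℕ → Term) → ℕ → Term
(τ ∘ˢ σ) i = substT τ (σ i)

_∷ˢ_ : Term → (ℕ → Term) → ℕ → Term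
(u ∷ˢ σ) zero    = u
(u ∷ˢ σ) (suc i) = σ i

↑ : ℕ → Term
↑ i = var (suc i)

renT≗substT : ∀ ρ → renT ρ ≗ substT (var ∘ ρ)
renT≗substT ρ (var i) = refl
renT≗substT ρ 𝟎       = refl
renT≗substT ρ (𝐒 t)   = cong 𝐒 (renT≗substT ρ t)

substT-cong : ∀ {σ τ} → σ ≗ τ → substT σ ≗ substT τ
substT-cong e (var i) = e i
substT-cong e 𝟎       = refl
substT-cong e (𝐒 t)   = cong 𝐒 (substT-cong e t)

lift-cong : ∀ {σ τ} → σ ≗ τ → lift σ ≗ lift τ
lift-cong e zero    = refl
lift-cong e (suc i) = cong (renT suc) (e i)

subst-cong : ∀ {σ τ} → σ ≗ τ → subst σ ≗ subst τ
subst-cong e ⊥'      = refl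
subst-cong e (s ≐ t) = cong₂ _≐_ (substT-cong e s) (substT-cong e t)
subst-cong e (φ ⇒ ψ) = cong₂ _⇒_ (subst-cong e φ) (subst-cong e ψ)
subst-cong e (φ ∧ ψ) = cong₂ _∧_ (subst-cong e φ) (subst-cong e ψ)
subst-cong e (φ ∨ ψ) = cong₂ _∨_ (subst-cong e φ) (subst-cong e ψ)
subst-cong e (∀' φ)  = cong ∀' (subst-cong (lift-cong e) φ)
subst-cong e (∃' φ)  = cong ∃' (subst-cong (lift-cong e) φ)

substT-∘ : ∀ τ σ t → substT τ (substT σ t) ≡ substT (τ ∘ˢ σ) t
substT-∘ τ σ (var i) = refl
substT-∘ τ σ 𝟎       = refl
substT-∘ τ σ (𝐒 t)   = cong 𝐒 (substT-∘ τ σ t)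

substT-lift-renT-suc : ∀ τ u → substT (lift τ) (renT suc u) ≡ renT suc (substT τ u)
substT-lift-renT-suc τ (var i) = refl
substT-lift-renT-suc τ 𝟎       = refl
substT-lift-renT-suc τ (𝐒 u)   = cong 𝐒 (substT-lift-renT-suc τ u)

lift-∘ : ∀ τ σ → lift τ ∘ˢ lift σ ≗ lift (τ ∘ˢ σ)
lift-∘ τ σ zero    = refl
lift-∘ τ σ (suc i) = substT-lift-renT-suc τ (σ i)

subst-∘ : ∀ τ σ φ → subst τ (subst σ φ) ≡ subst (τ ∘ˢ σ) φ
subst-∘ τ σ ⊥'      = refl
subst-∘ τ σ (s ≐ t) = cong₂ _≐_ (substT-∘ τ σ s) (substT-∘ τ σ t)
subst-∘ τ σ (φ ⇒ ψ) = cong₂ _⇒_ (subst-∘ τ σ φ) (subst-∘ τ σ ψ)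
subst-∘ τ σ (φ ∧ ψ) = cong₂ _∧_ (subst-∘ τ σ φ) (subst-∘ τ σ ψ)
subst-∘ τ σ (φ ∨ ψ) = cong₂ _∨_ (subst-∘ τ σ φ) (subst-∘ τ σ ψ)
subst-∘ τ σ (∀' φ)  = cong ∀' (trans (subst-∘ (lift τ) (lift σ) φ) (subst-cong (lift-∘ τ σ) φ))
subst-∘ τ σ (∃' φ)  = cong ∃' (trans (subst-∘ (lift τ) (lift σ) φ) (subst-cong (lift-∘ τ σ) φ))

substT-var : ∀ t → substT var t ≡ t
substT-var (var i) = refl
substT-var 𝟎       = refl
substT-var (𝐒 t)   = cong 𝐒 (substT-var t)

lift-var : ∀ {σ} → σ ≗ var → lift σ ≗ var
lift-var e zero    = refl
lift-var e (suc i) = cong (renT suc) (e i)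

subst-var : ∀ {σ} → σ ≗ var → ∀ φ → subst σ φ ≡ φ
subst-var e ⊥'      = refl
subst-var e (s ≐ t) =
  cong₂ _≐_ (trans (substT-cong e s) (substT-var s)) (trans (substT-cong e t) (substT-var t))
subst-var e (φ ⇒ ψ) = cong₂ _⇒_ (subst-var e φ) (subst-var e ψ)
subst-var e (φ ∧ ψ) = cong₂ _∧_ (subst-var e φ) (subst-var e ψ)
subst-var e (φ ∨ ψ) = cong₂ _∨_ (subst-var e φ) (subst-var e ψ)
subst-var e (∀' φ)  = cong ∀' (subst-var (lift-var e) φ)
subst-var e (∃' φ)  = cong ∃' (subst-var (lift-var e) φ)

substT-single-renT-suc : ∀ u v → substT (single u) (renT suc v) ≡ v
substT-single-renT-suc u (var i) = refl
substT-single-renT-suc u 𝟎       = refl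
substT-single-renT-suc u (𝐒 v)   = cong 𝐒 (substT-single-renT-suc u v)

substT-num : ∀ σ a → substT σ (num a) ≡ num a
substT-num σ zero    = refl
substT-num σ (suc a) = cong 𝐒 (substT-num σ a)

renT-num : ∀ ρ a → renT ρ (num a) ≡ num a
renT-num ρ a = trans (renT≗substT ρ (num a)) (substT-num (var ∘ ρ) a)

shift-subst : ∀ σ φ → shift (subst σ φ) ≡ subst (lift σ) (shift φ)
shift-subst σ φ = trans (subst-∘ ↑ σ φ)
  (trans (subst-cong (λ i → sym (renT≗substT suc (σ i))) φ) (sym (subst-∘ (lift σ) ↑ φ)))

lift-[] : ∀ σ φ u → (subst (lift σ) φ) [ u ] ≡ subst (u ∷ˢ σ) φ
lift-[] σ φ u = trans (subst-∘ (single u) (lift σ) φ) (subst-cong e φ)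
  where
  e : single u ∘ˢ lift σ ≗ u ∷ˢ σ
  e zero    = refl
  e (suc i) = substT-single-renT-suc u (σ i)

subst-[] : ∀ σ φ t → (subst (lift σ) φ) [ substT σ t ] ≡ subst σ (φ [ t ])
subst-[] σ φ t = trans (lift-[] σ φ (substT σ t)) (trans (subst-cong e φ) (sym (subst-∘ σ (single t) φ)))
  where
  e : substT σ t ∷ˢ σ ≗ σ ∘ˢ single t
  e zero    = refl
  e (suc i) = refl

shift-∃-lift : ∀ σ φ → shift (∃' (subst (lift σ) φ)) ≡ ∃' (subst (lift (renT suc ∘ σ)) φ)
shift-∃-lift σ φ = cong ∃' (trans (subst-∘ (lift ↑) (lift σ) φ) (subst-cong e φ))
  where
  e : lift ↑ ∘ˢ lift σ ≗ lift (renT suc ∘ σ)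
  e zero    = refl
  e (suc i) = trans (substT-lift-renT-suc ↑ (σ i)) (cong (renT suc) (sym (renT≗substT suc (σ i))))

lift-↑-[var0] : ∀ φ → (subst (lift ↑) φ) [ var 0 ] ≡ φ
lift-↑-[var0] φ = trans (lift-[] ↑ φ (var 0)) (subst-var e φ)
  where
  e : var 0 ∷ˢ ↑ ≗ var
  e zero    = refl
  e (suc i) = refl

weaken : ∀ {Γ Δ φ} → Γ ⊆ Δ → Γ ⊢ φ → Δ ⊢ φ
weaken s (assum p)     = assum (s p)
weaken s (⇒I d)        = ⇒I (weaken (∷⁺ʳ _ s) d)
weaken s (⇒E d e)      = ⇒E (weaken s d) (weaken s e)
weaken s (∧I d e)      = ∧I (weaken s d) (weaken s e)
weaken s (∧E₁ d)       = ∧E₁ (weaken s d)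
weaken s (∧E₂ d)       = ∧E₂ (weaken s d)
weaken s (∨I₁ d)       = ∨I₁ (weaken s d)
weaken s (∨I₂ d)       = ∨I₂ (weaken s d)
weaken s (∨E d e f)    = ∨E (weaken s d) (weaken (∷⁺ʳ _ s) e) (weaken (∷⁺ʳ _ s) f)
weaken s (raa d)       = raa (weaken (∷⁺ʳ _ s) d)
weaken s (∀I d)        = ∀I (weaken (map⁺ shift s) d)
weaken s (∀E t d)      = ∀E t (weaken s d)
weaken s (∃I t d)      = ∃I t (weaken s d)
weaken s (∃E d e)      = ∃E (weaken s d) (weaken (∷⁺ʳ _ (map⁺ shift s)) e)
weaken s (≐refl t)     = ≐refl t
weaken s (≐subst d e)  = ≐subst (weaken s d) (weaken s e)

weaken-∷ : ∀ {Γ φ ψ} → Γ ⊢ φ → ψ ∷ Γ ⊢ φ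
weaken-∷ = weaken there

map-shift-subst : ∀ σ Γ → map shift (map (subst σ) Γ) ≡ map (subst (lift σ)) (map shift Γ)
map-shift-subst σ []      = refl
map-shift-subst σ (ψ ∷ Γ) = cong₂ _∷_ (shift-subst σ ψ) (map-shift-subst σ Γ)

⊢-subst : ∀ {Γ φ} σ → Γ ⊢ φ → map (subst σ) Γ ⊢ subst σ φ
⊢-subst σ (assum p)  = assum (∈-map⁺ (subst σ) p)
⊢-subst σ (⇒I d)     = ⇒I (⊢-subst σ d)
⊢-subst σ (⇒E d e)   = ⇒E (⊢-subst σ d) (⊢-subst σ e)
⊢-subst σ (∧I d e)   = ∧I (⊢-subst σ d) (⊢-subst σ e)
⊢-subst σ (∧E₁ d)    = ∧E₁ (⊢-subst σ d)
⊢-subst σ (∧E₂ d)    = ∧E₂ (⊢-subst σ d)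
⊢-subst σ (∨I₁ d)    = ∨I₁ (⊢-subst σ d)
⊢-subst σ (∨I₂ d)    = ∨I₂ (⊢-subst σ d)
⊢-subst σ (∨E d e f) = ∨E (⊢-subst σ d) (⊢-subst σ e) (⊢-subst σ f)
⊢-subst σ (raa d)    = raa (⊢-subst σ d)
⊢-subst {Γ} σ (∀I {φ} d) =
  ∀I (≡.subst (_⊢ subst (lift σ) φ) (sym (map-shift-subst σ Γ)) (⊢-subst (lift σ) d))
⊢-subst σ (∀E {φ} t d) = ≡.subst (_ ⊢_) (subst-[] σ φ t) (∀E (substT σ t) (⊢-subst σ d))
⊢-subst σ (∃I {φ} t d) = ∃I (substT σ t) (≡.subst (_ ⊢_) (sym (subst-[] σ φ t)) (⊢-subst σ d))
⊢-subst {Γ} σ (∃E {φ} {ψ} d e) = ∃E (⊢-subst σ d)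
  (≡.subst₂ (λ Δ χ → subst (lift σ) φ ∷ Δ ⊢ χ) (sym (map-shift-subst σ Γ)) (sym (shift-subst σ ψ))
    (⊢-subst (lift σ) e))
⊢-subst σ (≐refl t) = ≐refl (substT σ t)
⊢-subst σ (≐subst {φ} {s} {t} d e) = ≡.subst (_ ⊢_) (subst-[] σ φ t)
  (≐subst (⊢-subst σ d) (≡.subst (_ ⊢_) (sym (subst-[] σ φ s)) (⊢-subst σ e)))

⊢-shift : ∀ {Γ φ} → Γ ⊢ φ → map shift Γ ⊢ shift φ
⊢-shift = ⊢-subst ↑

⊢-subst-cong : ∀ {Γ σ τ} φ → σ ≗ τ → Γ ⊢ subst σ φ → Γ ⊢ subst τ φ
⊢-subst-cong {Γ} φ e = ≡.subst (Γ ⊢_) (subst-cong e φ)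

⊢-explode : ∀ {Γ φ} → Γ ⊢ ⊥' → Γ ⊢ φ
⊢-explode d = raa (weaken-∷ d)

⊢-lem : ∀ {Γ} φ → Γ ⊢ φ ∨ ¬' φ
⊢-lem φ = raa (⇒E (assum (here refl))
  (∨I₂ (⇒I (⇒E (assum (there (here refl))) (∨I₁ (assum (here refl)))))))

⊢-sym : ∀ {Γ s t} → Γ ⊢ s ≐ t → Γ ⊢ t ≐ s
⊢-sym {Γ} {s} {t} d = ≡.subst (λ u → Γ ⊢ t ≐ u) (substT-single-renT-suc t s)
  (≐subst {φ = var 0 ≐ renT suc s} d
    (≡.subst (λ u → Γ ⊢ s ≐ u) (sym (substT-single-renT-suc s s)) (≐refl s)))

⊢-replace : ∀ {Γ s t} σ φ → Γ ⊢ s ≐ t → Γ ⊢ subst (s ∷ˢ σ) φ → Γ ⊢ subst (t ∷ˢ σ) φ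
⊢-replace {Γ} {s} {t} σ φ e d = ≡.subst (Γ ⊢_) (lift-[] σ φ t)
  (≐subst e (≡.subst (Γ ⊢_) (sym (lift-[] σ φ s)) d))

⊢-∃I-∷ˢ : ∀ {Γ u} σ φ → Γ ⊢ subst (u ∷ˢ σ) φ → Γ ⊢ ∃' (subst (lift σ) φ)
⊢-∃I-∷ˢ {Γ} {u} σ φ d = ∃I u (≡.subst (Γ ⊢_) (sym (lift-[] σ φ u)) d)

⊢-∀-∃¬ : ∀ {Γ φ} → Γ ⊢ ∀' φ → Γ ⊢ ∃' (¬' φ) → Γ ⊢ ⊥'
⊢-∀-∃¬ {Γ} {φ} a e = ∃E e (⇒E (assum (here refl))
  (≡.subst (¬' φ ∷ map shift Γ ⊢_) (lift-↑-[var0] φ) (∀E (var 0) (weaken-∷ (⊢-shift a)))))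

⊢-¬∃¬⇒∀ : ∀ {Γ φ} → Γ ⊢ ¬' (∃' (¬' φ)) → Γ ⊢ ∀' φ
⊢-¬∃¬⇒∀ {Γ} {φ} d = ∀I (raa {φ = φ} (⇒E (weaken-∷ (⊢-shift d))
  (∃I (var 0) (≡.subst (λ χ → ¬' φ ∷ map shift Γ ⊢ ¬' χ) (sym (lift-↑-[var0] φ)) (assum (here refl))))))

⊢-cases-below : ∀ (t : Term) B {Γ G} →
  (∀ k → k < B → ∀ {Δ} → Γ ⊆ Δ → t ≐ num k ∷ Δ ⊢ G) →
  (∀ {Δ} → Γ ⊆ Δ → (∀ j → j < B → Δ ⊢ ¬' (t ≐ num j)) → Δ ⊢ G) →
  Γ ⊢ G
⊢-cases-below t zero      numeral apart = apart (λ p → p) (λ j ())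
⊢-cases-below t (suc B) {Γ} numeral apart = ∨E (⊢-lem (t ≐ num B))
  (numeral B ≤-refl (λ p → p))
  (⊢-cases-below t B
    (λ k k<B Γ'⊆Δ → numeral k (m<n⇒m<1+n k<B) (Γ'⊆Δ ∘ there))
    (λ Γ'⊆Δ apart-B → apart (Γ'⊆Δ ∘ there) (apart-suc (Γ'⊆Δ (here refl)) apart-B)))
  where
  apart-suc : ∀ {Δ} → ¬' (t ≐ num B) ∈ Δ → (∀ j → j < B → Δ ⊢ ¬' (t ≐ num j)) →
    ∀ j → j < suc B → Δ ⊢ ¬' (t ≐ num j)
  apart-suc t≢B apart-B j j<sB with j ≟ B
  ... | yes refl = assum t≢B
  ... | no j≢B   = apart-B j (≤∧≢⇒< (≤-pred j<sB) j≢B)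

ProvesSucc₁₂ : List Formula → Set
ProvesSucc₁₂ Γ = (Γ ⊢ succ-ax₁) × (Γ ⊢ succ-ax₂)

ProvesSucc₁₂-weaken : ∀ {Γ Δ} → Γ ⊆ Δ → ProvesSucc₁₂ Γ → ProvesSucc₁₂ Δ
ProvesSucc₁₂-weaken s (a₁ , a₂) = weaken s a₁ , weaken s a₂

ProvesSucc₁₂-shift : ∀ {Γ} → ProvesSucc₁₂ Γ → ProvesSucc₁₂ (map shift Γ)
ProvesSucc₁₂-shift (a₁ , a₂) = ⊢-shift a₁ , ⊢-shift a₂

⊢-𝐒-injective : ∀ {Γ s t} → ProvesSucc₁₂ Γ → Γ ⊢ 𝐒 s ≐ 𝐒 t → Γ ⊢ s ≐ t
⊢-𝐒-injective {Γ} {s} {t} (a₁ , _) =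
  ⇒E (≡.subst (λ u → Γ ⊢ 𝐒 u ≐ 𝐒 t ⇒ u ≐ t) (substT-single-renT-suc t s) (∀E t (∀E s a₁)))

⊢-𝐒≢𝟎 : ∀ {Γ s} → ProvesSucc₁₂ Γ → Γ ⊢ 𝐒 s ≐ 𝟎 → Γ ⊢ ⊥'
⊢-𝐒≢𝟎 {s = s} (_ , a₂) = ⇒E (∀E s a₂)

⊢-num-distinct : ∀ {Γ} → ProvesSucc₁₂ Γ → ∀ x y → x ≢ y → Γ ⊢ num x ≐ num y → Γ ⊢ ⊥'
⊢-num-distinct ax zero    zero    x≢y d = ⊥-elim (x≢y refl)
⊢-num-distinct ax zero    (suc y) x≢y d = ⊢-𝐒≢𝟎 ax (⊢-sym d)
⊢-num-distinct ax (suc x) zero    x≢y d = ⊢-𝐒≢𝟎 ax d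
⊢-num-distinct ax (suc x) (suc y) x≢y d = ⊢-num-distinct ax x y (x≢y ∘ cong suc) (⊢-𝐒-injective ax d)

𝐒ⁿ : ℕ → Term → Term
𝐒ⁿ zero    w = w
𝐒ⁿ (suc c) w = 𝐒 (𝐒ⁿ c w)

⊢-𝐒ⁿ≐num : ∀ {Γ w} → ProvesSucc₁₂ Γ → ∀ c x → Γ ⊢ 𝐒ⁿ c w ≐ num x →
  (c ≤ x × Γ ⊢ w ≐ num (x ∸ c)) ⊎ Γ ⊢ ⊥'
⊢-𝐒ⁿ≐num ax zero    x       d = inj₁ (z≤n , d)
⊢-𝐒ⁿ≐num ax (suc c) zero    d = inj₂ (⊢-𝐒≢𝟎 ax d)
⊢-𝐒ⁿ≐num ax (suc c) (suc x) d with ⊢-𝐒ⁿ≐num ax c x (⊢-𝐒-injective ax d)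
... | inj₁ (c≤x , d′) = inj₁ (s≤s c≤x , d′)
... | inj₂ absurd     = inj₂ absurd

-- A configuration interprets each free variable on the left and on the right of a
-- transfer, either by a numeral on each side or by one term common to both sides.
data Entry : Set where
  numerals : ℕ → ℕ → Entry
  shared   : Term → Entry

leftTerm rightTerm : Entry → Term
leftTerm  (numerals a b) = num a
leftTerm  (shared t)     = t
rightTerm (numerals a b) = num b
rightTerm (shared t)     = t

swapEntry shiftEntry : Entry → Entry
swapEntry  (numerals a b) = numerals b a
swapEntry  (shared t)     = shared t
shiftEntry (numerals a b) = numerals a b
shiftEntry (shared t)     = shared (renT suc t)

Config : Set
Config = ℕ → Entry

left right : Config → ℕ → Term
left  E i = leftTerm (E i)
right E i = rightTerm (E i)

swapᶜ shiftᶜ : Config → Config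
swapᶜ  E i = swapEntry (E i)
shiftᶜ E i = shiftEntry (E i)

_∷ᶜ_ : Entry → Config → Config
(e ∷ᶜ E) zero    = e
(e ∷ᶜ E) (suc i) = E i

left-swapᶜ : ∀ E → left (swapᶜ E) ≗ right E
left-swapᶜ E i with E i
... | numerals a b = refl
... | shared t     = refl

right-swapᶜ : ∀ E → right (swapᶜ E) ≗ left E
right-swapᶜ E i with E i
... | numerals a b = refl
... | shared t     = refl

left-shiftᶜ : ∀ E → left (shiftᶜ E) ≗ renT suc ∘ left E
left-shiftᶜ E i with E i
... | numerals a b = sym (renT-num suc a)
... | shared t     = refl

right-shiftᶜ : ∀ E → right (shiftᶜ E) ≗ renT suc ∘ right E
right-shiftᶜ E i with E i
... | numerals a b = sym (renT-num suc b)
... | shared t     = refl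

left-∷ᶜ : ∀ e E → left (e ∷ᶜ E) ≗ leftTerm e ∷ˢ left E
left-∷ᶜ e E zero    = refl
left-∷ᶜ e E (suc i) = refl

right-∷ᶜ : ∀ e E → right (e ∷ᶜ E) ≗ rightTerm e ∷ˢ right E
right-∷ᶜ e E zero    = refl
right-∷ᶜ e E (suc i) = refl

open Equivalence using (to; from)

Agree : ℕ → ℕ → ℕ → ℕ → ℕ → Set
Agree T a b a′ b′ = ∀ x y → x ≤ T → y ≤ T → (a + x ≡ a′ + y) ⇔ (b + x ≡ b′ + y)

Agree-refl : ∀ T a b → Agree T a b a b
Agree-refl T a b x y _ _ =
  mk⇔ (cong (b +_) ∘ +-cancelˡ-≡ a x y) (cong (a +_) ∘ +-cancelˡ-≡ b x y)

Agree-sym : ∀ {T a b a′ b′} → Agree T a b a′ b′ → Agree T a′ b′ a b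
Agree-sym agree x y x≤T y≤T = mk⇔
  (λ e → sym (to (agree y x y≤T x≤T) (sym e)))
  (λ e → sym (from (agree y x y≤T x≤T) (sym e)))

Agree-swap : ∀ {T a b a′ b′} → Agree T a b a′ b′ → Agree T b a b′ a′
Agree-swap agree x y x≤T y≤T = ⇔-sym (agree x y x≤T y≤T)

Agree-mono : ∀ {T T′ a b a′ b′} → T′ ≤ T → Agree T a b a′ b′ → Agree T′ a b a′ b′
Agree-mono T′≤T agree x y x≤T′ y≤T′ = agree x y (≤-trans x≤T′ T′≤T) (≤-trans y≤T′ T′≤T)

IsPair : ℕ → Config → ℕ → ℕ → Set
IsPair K E a b = (a ≡ 0 × b ≡ 0) ⊎ ∃[ i ] i < K × E i ≡ numerals a b

Placed : List Formula → ℕ → ℕ → Entry → Set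
Placed Γ N T (numerals a b) = a < N × b < N
Placed Γ N T (shared t)     = ∀ j → j < N + T → Γ ⊢ ¬' (t ≐ num j)

record Invariant (Γ : List Formula) (K N T : ℕ) (E : Config) : Set where
  field
    N-positive : 0 < N
    placed     : ∀ i → i < K → Placed Γ N T (E i)
    agree      : ∀ {a b a′ b′} → IsPair K E a b → IsPair K E a′ b′ → Agree T a b a′ b′
open Invariant

pair-bounded : ∀ {Γ K N T E a b} → Invariant Γ K N T E → IsPair K E a b → a < N × b < N
pair-bounded inv (inj₁ (refl , refl)) = N-positive inv , N-positive inv
pair-bounded {Γ} {N = N} {T} inv (inj₂ (i , i<K , Eᵢ≡)) = ≡.subst (Placed Γ N T) Eᵢ≡ (placed inv i i<K)

IsPair-swapᶜ : ∀ {K E a b} → IsPair K (swapᶜ E) a b → IsPair K E b a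
IsPair-swapᶜ (inj₁ (a≡0 , b≡0)) = inj₁ (b≡0 , a≡0)
IsPair-swapᶜ {E = E} (inj₂ (i , i<K , Eᵢ≡)) = inj₂ (i , i<K , unswap (E i) Eᵢ≡)
  where
  unswap : ∀ e {a b} → swapEntry e ≡ numerals a b → e ≡ numerals b a
  unswap (numerals _ _) refl = refl

IsPair-shiftᶜ : ∀ {K E a b} → IsPair K (shiftᶜ E) a b → IsPair K E a b
IsPair-shiftᶜ (inj₁ zeros) = inj₁ zeros
IsPair-shiftᶜ {E = E} (inj₂ (i , i<K , Eᵢ≡)) = inj₂ (i , i<K , unshift (E i) Eᵢ≡)
  where
  unshift : ∀ e {a b} → shiftEntry e ≡ numerals a b → e ≡ numerals a b
  unshift (numerals _ _) refl = refl

IsPair-∷ᶜ : ∀ {K E e a b} → IsPair (suc K) (e ∷ᶜ E) a b → e ≡ numerals a b ⊎ IsPair K E a b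
IsPair-∷ᶜ (inj₁ zeros)                    = inj₂ (inj₁ zeros)
IsPair-∷ᶜ (inj₂ (zero , _ , e≡))          = inj₁ e≡
IsPair-∷ᶜ (inj₂ (suc i , s≤s i<K , Eᵢ≡)) = inj₂ (inj₂ (i , i<K , Eᵢ≡))

Invariant-swapᶜ : ∀ {Γ K N T E} → Invariant Γ K N T E → Invariant Γ K N T (swapᶜ E)
Invariant-swapᶜ {Γ} {N = N} {T} {E} inv = record
  { N-positive = N-positive inv
  ; placed     = λ i i<K → placed-swap (E i) (placed inv i i<K)
  ; agree      = λ p q → Agree-swap (agree inv (IsPair-swapᶜ p) (IsPair-swapᶜ q))
  }
  where
  placed-swap : ∀ e → Placed Γ N T e → Placed Γ N T (swapEntry e)
  placed-swap (numerals a b) (a<N , b<N) = b<N , a<N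
  placed-swap (shared t)     apart       = apart

Invariant-weaken : ∀ {Γ Δ K N T E} → Γ ⊆ Δ → Invariant Γ K N T E → Invariant Δ K N T E
Invariant-weaken {Γ} {Δ} {N = N} {T} {E} Γ⊆Δ inv = record
  { N-positive = N-positive inv
  ; placed     = λ i i<K → placed-weaken (E i) (placed inv i i<K)
  ; agree      = agree inv
  }
  where
  placed-weaken : ∀ e → Placed Γ N T e → Placed Δ N T e
  placed-weaken (numerals a b) bounds = bounds
  placed-weaken (shared t)     apart  = λ j j< → weaken Γ⊆Δ (apart j j<)

Invariant-shiftᶜ : ∀ {Γ K N T E} → Invariant Γ K N T E → Invariant (map shift Γ) K N T (shiftᶜ E)
Invariant-shiftᶜ {Γ} {N = N} {T} {E} inv = record
  { N-positive = N-positive inv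
  ; placed     = λ i i<K → placed-shift (E i) (placed inv i i<K)
  ; agree      = λ p q → agree inv (IsPair-shiftᶜ p) (IsPair-shiftᶜ q)
  }
  where
  placed-shift : ∀ e → Placed Γ N T e → Placed (map shift Γ) N T (shiftEntry e)
  placed-shift (numerals a b) bounds = bounds
  placed-shift (shared t)     apart  = λ j j< → ≡.subst (map shift Γ ⊢_)
    (cong₂ (λ u v → ¬' (u ≐ v)) (sym (renT≗substT suc t)) (substT-num ↑ j)) (⊢-shift (apart j j<))

AgreesWithPairs : ℕ → ℕ → Config → Entry → Set
AgreesWithPairs T K E (numerals k k′) = ∀ {a b} → IsPair K E a b → Agree T k k′ a b
AgreesWithPairs T K E (shared t)      = ⊤

Invariant-∷ᶜ : ∀ {Γ K N T E N′ T′} e → Invariant Γ K N T E →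
  N ≤ N′ → N′ + T′ ≤ N + T → T′ ≤ T → Placed Γ N′ T′ e → AgreesWithPairs T′ K E e →
  Invariant Γ (suc K) N′ T′ (e ∷ᶜ E)
Invariant-∷ᶜ {Γ} {K} {N} {T} {E} {N′} {T′} e inv N≤N′ N′+T′≤N+T T′≤T placed-e agree-e = record
  { N-positive = ≤-trans (N-positive inv) N≤N′
  ; placed     = placed′
  ; agree      = agree′
  }
  where
  placed-mono : ∀ e′ → Placed Γ N T e′ → Placed Γ N′ T′ e′
  placed-mono (numerals a b) (a<N , b<N) = ≤-trans a<N N≤N′ , ≤-trans b<N N≤N′
  placed-mono (shared t)     apart       = λ j j< → apart j (≤-trans j< N′+T′≤N+T)
  placed′ : ∀ i → i < suc K → Placed Γ N′ T′ ((e ∷ᶜ E) i)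
  placed′ zero    _         = placed-e
  placed′ (suc i) (s≤s i<K) = placed-mono (E i) (placed inv i i<K)
  new-pair : ∀ {a b} → e ≡ numerals a b → AgreesWithPairs T′ K E e →
    ∀ {a′ b′} → IsPair K E a′ b′ → Agree T′ a b a′ b′
  new-pair refl agree-e = agree-e
  agree′ : ∀ {a b a′ b′} → IsPair (suc K) (e ∷ᶜ E) a b → IsPair (suc K) (e ∷ᶜ E) a′ b′ →
    Agree T′ a b a′ b′
  agree′ p q with IsPair-∷ᶜ {K} {E} {e} p | IsPair-∷ᶜ {K} {E} {e} q
  ... | inj₁ refl | inj₁ refl = Agree-refl T′ _ _
  ... | inj₁ e≡   | inj₂ q′   = new-pair e≡ agree-e q′
  ... | inj₂ p′   | inj₁ e≡   = Agree-sym (new-pair e≡ agree-e p′)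
  ... | inj₂ p′   | inj₂ q′   = Agree-mono T′≤T (agree inv p′ q′)

Near : ℕ → ℕ → Config → ℕ → Set
Near T K E k = ∃[ a ] ∃[ b ] IsPair K E a b × ∃[ c₁ ] ∃[ c₂ ] c₁ ≤ T × c₂ ≤ T × k + c₁ ≡ a + c₂

offset-⇔ : ∀ {k a c₁ c₂} → k + c₁ ≡ a + c₂ → ∀ x a′ y →
  (k + x ≡ a′ + y) ⇔ (a + (c₂ + x) ≡ a′ + (y + c₁))
offset-⇔ {k} {a} {c₁} {c₂} k+c₁≡a+c₂ x a′ y = mk⇔
  (λ e → trans (sym rearrange) (trans (cong (_+ c₁) e) (+-assoc a′ y c₁)))
  (λ e → +-cancelʳ-≡ c₁ _ _ (trans rearrange (trans e (sym (+-assoc a′ y c₁)))))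
  where
  open ≡.≡-Reasoning
  rearrange : k + x + c₁ ≡ a + (c₂ + x)
  rearrange = begin
    k + x + c₁   ≡⟨ +-assoc k x c₁ ⟩
    k + (x + c₁) ≡⟨ cong (k +_) (+-comm x c₁) ⟩
    k + (c₁ + x) ≡⟨ +-assoc k c₁ x ⟨
    k + c₁ + x   ≡⟨ cong (_+ x) k+c₁≡a+c₂ ⟩
    a + c₂ + x   ≡⟨ +-assoc a c₂ x ⟩
    a + (c₂ + x) ∎

module _ {T′ T : ℕ} (2T′<T : suc (T′ + T′) ≤ T) where

  T′≤T : T′ ≤ T
  T′≤T = ≤-trans (m≤m+n T′ T′) (≤-trans (n≤1+n _) 2T′<T)

  +-≤-budget : ∀ {p q} → p ≤ T′ → q ≤ T′ → p + q ≤ T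
  +-≤-budget p≤ q≤ = ≤-trans (+-mono-≤ p≤ q≤) (≤-trans (n≤1+n _) 2T′<T)

  Invariant-∷-numerals : ∀ {Γ K N E k k′} → Invariant Γ K N T E → k < N + T′ → k′ ≤ N + T′ →
    AgreesWithPairs T′ K E (numerals k k′) →
    Invariant Γ (suc K) (suc (N + T′)) T′ (numerals k k′ ∷ᶜ E)
  Invariant-∷-numerals {N = N} inv k< k′≤ =
    Invariant-∷ᶜ (numerals _ _) inv (≤-trans (m≤m+n N T′) (n≤1+n _)) budget T′≤T
      (m<n⇒m<1+n k< , s≤s k′≤)
    where
    budget : suc (N + T′) + T′ ≤ N + T
    budget = ≡.subst (_≤ N + T) (trans (+-suc N (T′ + T′)) (cong suc (sym (+-assoc N T′ T′))))
      (+-monoʳ-≤ N 2T′<T)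

  -- From k + c₁ = a + c₂, the partner k′ of k is chosen with k′ + c₁ = b + c₂.
  extend-near : ∀ {Γ K N E k} → Invariant Γ K N T E → k < N + T′ → Near T′ K E k →
    ∃[ k′ ] Invariant Γ (suc K) (suc (N + T′)) T′ (numerals k k′ ∷ᶜ E)
  extend-near {N = N} {E} {k} inv k< (a , b , ab , c₁ , c₂ , c₁≤ , c₂≤ , k+c₁≡a+c₂) =
    b + c₂ ∸ c₁ , Invariant-∷-numerals inv k< k′≤ agree-k
    where
    c₁≤b+c₂ : c₁ ≤ b + c₂
    c₁≤b+c₂ = ≮⇒≥ λ b+c₂<c₁ → <-irrefl refl
      (≤-<-trans (m≤n+m c₁ k) (≡.subst (_< c₁) (sym (k+c₁≡b+c₂ b+c₂<c₁)) b+c₂<c₁))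
      where
      -- (a, b) agrees with (0, 0) at the offsets c₂ and b + c₂
      k+c₁≡b+c₂ : b + c₂ < c₁ → k + c₁ ≡ b + c₂
      k+c₁≡b+c₂ b+c₂<c₁ = trans k+c₁≡a+c₂
        (from (agree inv ab (inj₁ (refl , refl)) c₂ (b + c₂) (≤-trans c₂≤ T′≤T)
                (≤-trans (<⇒≤ b+c₂<c₁) (≤-trans c₁≤ T′≤T))) refl)
    k′≤ : b + c₂ ∸ c₁ ≤ N + T′
    k′≤ = ≤-trans (m∸n≤m (b + c₂) c₁) (<⇒≤ (+-mono-<-≤ (proj₂ (pair-bounded inv ab)) c₂≤))
    agree-k : AgreesWithPairs T′ _ E (numerals k (b + c₂ ∸ c₁))
    agree-k {a₂} {b₂} a₂b₂ x y x≤ y≤ =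
      ⇔-sym (offset-⇔ {a = b} {c₂ = c₂} (m∸n+n≡m c₁≤b+c₂) x b₂ y)
        ⇔-∘ (agree inv ab a₂b₂ (c₂ + x) (y + c₁) (+-≤-budget c₂≤ x≤) (+-≤-budget y≤ c₁≤)
        ⇔-∘ offset-⇔ {a = a} {c₂ = c₂} k+c₁≡a+c₂ x a₂ y)

  extend-far : ∀ {Γ K N E k} → Invariant Γ K N T E → k < N + T′ → ¬ Near T′ K E k →
    Invariant Γ (suc K) (suc (N + T′)) T′ (numerals k (N + T′) ∷ᶜ E)
  extend-far {N = N} inv k< far = Invariant-∷-numerals inv k< ≤-refl agree-k
    where
    agree-k : AgreesWithPairs T′ _ _ (numerals _ (N + T′))
    agree-k {a₂} {b₂} a₂b₂ x y x≤ y≤ = mk⇔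
      (λ e → ⊥-elim (far (a₂ , b₂ , a₂b₂ , x , y , x≤ , y≤ , e)))
      (λ e → ⊥-elim (<-irrefl (sym e)
        (≤-trans (+-mono-<-≤ (proj₂ (pair-bounded inv a₂b₂)) y≤) (m≤m+n (N + T′) x))))

  extend : ExcludedMiddle 0ℓ → ∀ {Γ K N E k} → Invariant Γ K N T E → k < N + T′ →
    ∃[ k′ ] Invariant Γ (suc K) (suc (N + T′)) T′ (numerals k k′ ∷ᶜ E)
  extend em {K = K} {E = E} {k} inv k< with em {Near T′ K E k}
  ... | yes near = extend-near inv k< near
  ... | no far   = _ , extend-far inv k< far

depth : Term → ℕ
depth (var i) = 0
depth 𝟎       = 0
depth (𝐒 t)   = suc (depth t)

data View (Γ : List Formula) (K N T : ℕ) (E : Config) (t : Term) : Set where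
  numeral : ∀ {a b} → IsPair K E a b →
    substT (left E) t ≡ num (depth t + a) → substT (right E) t ≡ num (depth t + b) →
    View Γ K N T E t
  above-shared : ∀ {w} → Placed Γ N T (shared w) →
    substT (left E) t ≡ 𝐒ⁿ (depth t) w → substT (right E) t ≡ 𝐒ⁿ (depth t) w →
    View Γ K N T E t

view : ∀ {Γ K N T E t} → Invariant Γ K N T E → WFT K t → View Γ K N T E t
view {E = E} inv (var {i} i<K) with E i in Eᵢ≡ | placed inv i i<K
... | numerals a b | _     = numeral (inj₂ (i , i<K , Eᵢ≡)) (cong leftTerm Eᵢ≡) (cong rightTerm Eᵢ≡)
... | shared w     | apart = above-shared apart (cong leftTerm Eᵢ≡) (cong rightTerm Eᵢ≡)
view inv 𝟎 = numeral (inj₁ (refl , refl)) refl refl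
view inv (𝐒 t) with view inv t
... | numeral ab l≡ r≡        = numeral ab (cong 𝐒 l≡) (cong 𝐒 r≡)
... | above-shared apart l≡ r≡ = above-shared apart (cong 𝐒 l≡) (cong 𝐒 r≡)

⊢-shared≢numeral : ∀ {Γ K N T E a b w} → ProvesSucc₁₂ Γ → Invariant Γ K N T E →
  IsPair K E a b → Placed Γ N T (shared w) →
  ∀ c d → c ≤ T → Γ ⊢ 𝐒ⁿ d w ≐ num (c + a) → Γ ⊢ ⊥'
⊢-shared≢numeral {N = N} {T} {a = a} ax inv ab apart c d c≤T h with ⊢-𝐒ⁿ≐num ax d (c + a) h
... | inj₂ absurd       = absurd
... | inj₁ (_ , w≐num) = ⇒E (apart (c + a ∸ d) below) w≐num
  where
  below : c + a ∸ d < N + T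
  below = ≤-<-trans (m∸n≤m (c + a) d)
    (≡.subst (_< N + T) (+-comm a c) (+-mono-<-≤ (proj₁ (pair-bounded inv ab)) c≤T))

transfer-≐ : ∀ {Γ K N T E s t} → WFT K s → WFT K t → depth s ≤ T → depth t ≤ T →
  ProvesSucc₁₂ Γ → Invariant Γ K N T E →
  Γ ⊢ substT (left E) s ≐ substT (left E) t → Γ ⊢ substT (right E) s ≐ substT (right E) t
transfer-≐ {Γ} {s = s} {t} ws wt ds dt ax inv h with view inv ws | view inv wt
... | numeral {a} {b} ab ls rs | numeral {a′} {b′} a′b′ lt rt with depth s + a ≟ depth t + a′
...   | yes eq = ≡.subst₂ (λ u v → Γ ⊢ u ≐ v) (sym rs) (sym rt)
                   (≡.subst (λ n → Γ ⊢ num (depth s + b) ≐ num n) eq′ (≐refl _))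
  where
  eq′ : depth s + b ≡ depth t + b′
  eq′ = trans (+-comm _ b) (trans
    (to (agree inv ab a′b′ (depth s) (depth t) ds dt) (trans (+-comm a _) (trans eq (+-comm _ a′))))
    (+-comm b′ _))
...   | no neq = ⊢-explode (⊢-num-distinct ax _ _ neq (≡.subst₂ (λ u v → Γ ⊢ u ≐ v) ls lt h))
transfer-≐ {Γ} {s = s} {t} ws wt ds dt ax inv h | numeral ab ls _ | above-shared apart lt _ =
  ⊢-explode (⊢-shared≢numeral ax inv ab apart (depth s) (depth t) ds
    (⊢-sym (≡.subst₂ (λ u v → Γ ⊢ u ≐ v) ls lt h)))
transfer-≐ {Γ} {s = s} {t} ws wt ds dt ax inv h | above-shared apart ls _ | numeral ab lt _ =
  ⊢-explode (⊢-shared≢numeral ax inv ab apart (depth t) (depth s) dt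
    (≡.subst₂ (λ u v → Γ ⊢ u ≐ v) ls lt h))
transfer-≐ {Γ} ws wt ds dt ax inv h | above-shared _ ls rs | above-shared _ lt rt =
  ≡.subst₂ (λ u v → Γ ⊢ u ≐ v) (trans ls (sym rs)) (trans lt (sym rt)) h

-- `extend` halves the budget at each quantifier, hence 2r + 1.
rank : Formula → ℕ
rank ⊥'      = 0
rank (s ≐ t) = depth s ⊔ depth t
rank (φ ⇒ ψ) = rank φ ⊔ rank ψ
rank (φ ∧ ψ) = rank φ ⊔ rank ψ
rank (φ ∨ ψ) = rank φ ⊔ rank ψ
rank (∀' φ)  = suc (rank φ + rank φ)
rank (∃' φ)  = suc (rank φ + rank φ)

Transfers : ℕ → ℕ → Formula → Set
Transfers K T φ = ∀ {Γ N E} → ProvesSucc₁₂ Γ → Invariant Γ K N T E →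
  Γ ⊢ subst (left E) φ → Γ ⊢ subst (right E) φ

Transfers-reverse : ∀ {K T φ} → Transfers K T φ → ∀ {Γ N E} → ProvesSucc₁₂ Γ → Invariant Γ K N T E →
  Γ ⊢ subst (right E) φ → Γ ⊢ subst (left E) φ
Transfers-reverse {φ = φ} tφ {E = E} ax inv d =
  ⊢-subst-cong φ (right-swapᶜ E) (tφ ax (Invariant-swapᶜ inv) (⊢-subst-cong φ (sym ∘ left-swapᶜ E) d))

Transfers-⊥ : ∀ {K T} → Transfers K T ⊥'
Transfers-⊥ _ _ d = d

Transfers-⇒ : ∀ {K T φ ψ} → Transfers K T φ → Transfers K T ψ → Transfers K T (φ ⇒ ψ)
Transfers-⇒ tφ tψ ax inv d =
  ⇒I (tψ ax′ inv′ (⇒E (weaken-∷ d) (Transfers-reverse tφ ax′ inv′ (assum (here refl)))))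
  where
  ax′  = ProvesSucc₁₂-weaken there ax
  inv′ = Invariant-weaken there inv

Transfers-¬ : ∀ {K T φ} → Transfers K T φ → Transfers K T (¬' φ)
Transfers-¬ tφ = Transfers-⇒ tφ Transfers-⊥

Transfers-∧ : ∀ {K T φ ψ} → Transfers K T φ → Transfers K T ψ → Transfers K T (φ ∧ ψ)
Transfers-∧ tφ tψ ax inv d = ∧I (tφ ax inv (∧E₁ d)) (tψ ax inv (∧E₂ d))

Transfers-∨ : ∀ {K T φ ψ} → Transfers K T φ → Transfers K T ψ → Transfers K T (φ ∨ ψ)
Transfers-∨ tφ tψ ax inv d = ∨E d
  (∨I₁ (tφ (ProvesSucc₁₂-weaken there ax) (Invariant-weaken there inv) (assum (here refl))))
  (∨I₂ (tψ (ProvesSucc₁₂-weaken there ax) (Invariant-weaken there inv) (assum (here refl))))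

Transfers-∀ : ∀ {K T φ} → Transfers K T (¬' (∃' (¬' φ))) → Transfers K T (∀' φ)
Transfers-∀ t ax inv d = ⊢-¬∃¬⇒∀ (t ax inv (⇒I (⊢-∀-∃¬ (weaken-∷ d) (assum (here refl)))))

module _ {K T′ T : ℕ} {φ : Formula} (tφ : Transfers (suc K) T′ φ) (2T′<T : suc (T′ + T′) ≤ T) where

  ∃-intro-numeral : ExcludedMiddle 0ℓ → ∀ {Δ N E k} → ProvesSucc₁₂ Δ → Invariant Δ K N T E →
    k < N + T′ → Δ ⊢ subst (num k ∷ˢ left E) φ → Δ ⊢ subst (right E) (∃' φ)
  ∃-intro-numeral em {E = E} ax inv k< d with extend 2T′<T em inv k<
  ... | _ , inv′ = ⊢-∃I-∷ˢ (right E) φ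
    (⊢-subst-cong φ (right-∷ᶜ _ E) (tφ ax inv′ (⊢-subst-cong φ (sym ∘ left-∷ᶜ _ E) d)))

  ∃-intro-shared : ∀ {Δ N E u} → ProvesSucc₁₂ Δ → Invariant Δ K N T E →
    (∀ j → j < N + T′ → Δ ⊢ ¬' (u ≐ num j)) → Δ ⊢ subst (u ∷ˢ left E) φ → Δ ⊢ subst (right E) (∃' φ)
  ∃-intro-shared {N = N} {E} {u} ax inv apart d = ⊢-∃I-∷ˢ (right E) φ
    (⊢-subst-cong φ (right-∷ᶜ _ E) (tφ ax inv′ (⊢-subst-cong φ (sym ∘ left-∷ᶜ _ E) d)))
    where
    inv′ = Invariant-∷ᶜ (shared u) inv ≤-refl (+-monoʳ-≤ N (T′≤T 2T′<T)) (T′≤T 2T′<T) apart _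

  -- Split on whether the witness is a numeral below N + T′; if so, `extend` finds its partner.
  transfer-∃ : ExcludedMiddle 0ℓ → Transfers K T (∃' φ)
  transfer-∃ em {Γ} {N} {E} ax inv h = ∃E h
    (≡.subst (Γ₁ ⊢_) (sym (shift-∃-lift (right E) φ)) (⊢-subst-cong (∃' φ) (right-shiftᶜ E) body))
    where
    Γ₁   = subst (lift (left E)) φ ∷ map shift Γ
    ax₁  = ProvesSucc₁₂-weaken there (ProvesSucc₁₂-shift ax)
    inv₁ = Invariant-weaken there (Invariant-shiftᶜ inv)
    lift-left : lift (left E) ≗ var 0 ∷ˢ left (shiftᶜ E)
    lift-left zero    = refl
    lift-left (suc i) = sym (left-shiftᶜ E i)
    witness : Γ₁ ⊢ subst (var 0 ∷ˢ left (shiftᶜ E)) φ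
    witness = ⊢-subst-cong φ lift-left (assum (here refl))
    body : Γ₁ ⊢ subst (right (shiftᶜ E)) (∃' φ)
    body = ⊢-cases-below (var 0) (N + T′)
      (λ k k< Γ₁⊆Δ → ∃-intro-numeral em (ProvesSucc₁₂-weaken (there ∘ Γ₁⊆Δ) ax₁)
        (Invariant-weaken (there ∘ Γ₁⊆Δ) inv₁) k<
        (⊢-replace (left (shiftᶜ E)) φ (assum (here refl)) (weaken (there ∘ Γ₁⊆Δ) witness)))
      (λ Γ₁⊆Δ apart → ∃-intro-shared (ProvesSucc₁₂-weaken Γ₁⊆Δ ax₁) (Invariant-weaken Γ₁⊆Δ inv₁)
        apart (weaken Γ₁⊆Δ witness))

transfer : ExcludedMiddle 0ℓ → ∀ {K φ T} → WF K φ → rank φ ≤ T → Transfers K T φ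
transfer em ⊥'        _  = Transfers-⊥
transfer em (ws ≐ wt) r≤ = transfer-≐ ws wt (m⊔n≤o⇒m≤o _ _ r≤) (m⊔n≤o⇒n≤o _ _ r≤)
transfer em (wφ ⇒ wψ) r≤ =
  Transfers-⇒ (transfer em wφ (m⊔n≤o⇒m≤o _ _ r≤)) (transfer em wψ (m⊔n≤o⇒n≤o _ _ r≤))
transfer em (wφ ∧ wψ) r≤ =
  Transfers-∧ (transfer em wφ (m⊔n≤o⇒m≤o _ _ r≤)) (transfer em wψ (m⊔n≤o⇒n≤o _ _ r≤))
transfer em (wφ ∨ wψ) r≤ =
  Transfers-∨ (transfer em wφ (m⊔n≤o⇒m≤o _ _ r≤)) (transfer em wψ (m⊔n≤o⇒n≤o _ _ r≤))
transfer em (∃' wφ)   r≤ = transfer-∃ (transfer em wφ ≤-refl) r≤ em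
transfer em (∀' wφ)   r≤ =
  Transfers-∀ (Transfers-¬ (transfer-∃ (Transfers-¬ (transfer em wφ ≤-refl)) r≤ em))

initial : ℕ → ℕ → Config
initial n m zero    = numerals n m
initial n m (suc i) = shared (var i)

IsPair-initial : ∀ {n m a b} → IsPair 1 (initial n m) a b → (a ≡ 0 × b ≡ 0) ⊎ (a ≡ n × b ≡ m)
IsPair-initial (inj₁ zeros)                 = inj₁ zeros
IsPair-initial (inj₂ (zero , _ , refl))     = inj₂ (refl , refl)
IsPair-initial (inj₂ (suc i , s≤s () , _))

Agree-far : ∀ {B n m} → B < n → B < m → Agree B n m 0 0
Agree-far {B} {n} {m} B<n B<m x y _ y≤B = mk⇔
  (λ e → ⊥-elim (<-irrefl (sym e) (≤-<-trans y≤B (≤-trans B<n (m≤m+n n x)))))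
  (λ e → ⊥-elim (<-irrefl (sym e) (≤-<-trans y≤B (≤-trans B<m (m≤m+n m x)))))

Invariant-initial : ∀ {Γ B n m} → B < n → B < m → Invariant Γ 1 (suc (n + m)) B (initial n m)
Invariant-initial {B = B} {n} {m} B<n B<m = record
  { N-positive = s≤s z≤n
  ; placed     = λ { zero _ → s≤s (m≤m+n n m) , s≤s (m≤n+m m n) ; (suc i) (s≤s ()) }
  ; agree      = λ p q → agree′ (IsPair-initial p) (IsPair-initial q)
  }
  where
  agree′ : ∀ {a b a′ b′} → (a ≡ 0 × b ≡ 0) ⊎ (a ≡ n × b ≡ m) →
    (a′ ≡ 0 × b′ ≡ 0) ⊎ (a′ ≡ n × b′ ≡ m) → Agree B a b a′ b′
  agree′ (inj₁ (refl , refl)) (inj₁ (refl , refl)) = Agree-refl B 0 0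
  agree′ (inj₁ (refl , refl)) (inj₂ (refl , refl)) = Agree-sym (Agree-far B<n B<m)
  agree′ (inj₂ (refl , refl)) (inj₁ (refl , refl)) = Agree-far B<n B<m
  agree′ (inj₂ (refl , refl)) (inj₂ (refl , refl)) = Agree-refl B n m

numeral-transfer : ExcludedMiddle 0ℓ → ∀ {Γ φ n m} → WF 1 φ → rank φ < n → rank φ < m →
  ProvesSucc₁₂ Γ → Γ ⊢ φ [ num n ] → Γ ⊢ φ [ num m ]
numeral-transfer em {φ = φ} {n} {m} wφ r<n r<m ax d =
  ⊢-subst-cong φ right≗ (transfer em wφ ≤-refl ax (Invariant-initial r<n r<m) (⊢-subst-cong φ left≗ d))
  where
  left≗ : single (num n) ≗ left (initial n m)
  left≗ zero    = refl
  left≗ (suc i) = refl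
  right≗ : right (initial n m) ≗ single (num m)
  right≗ zero    = refl
  right≗ (suc i) = refl

succ-context : ∀ {S} → ExtendsSucc⁻ S → ∃[ Γ ] All S Γ × ProvesSucc₁₂ Γ
succ-context ((Γ₁ , S₁ , d₁) , (Γ₂ , S₂ , d₂) , _) =
  Γ₁ ++ Γ₂ , ++⁺ S₁ S₂ , weaken (xs⊆xs++ys Γ₁ Γ₂) d₁ , weaken (xs⊆ys++xs Γ₂ Γ₁) d₂

⊩-with-succ : ∀ {S ψ} → ExtendsSucc⁻ S → S ⊩ ψ → ∃[ Γ ] All S Γ × ProvesSucc₁₂ Γ × Γ ⊢ ψ
⊩-with-succ ext (Γ , SΓ , d) with succ-context ext
... | Γ₀ , SΓ₀ , ax =
  Γ ++ Γ₀ , ++⁺ SΓ SΓ₀ , ProvesSucc₁₂-weaken (xs⊆ys++xs Γ₀ Γ) ax , weaken (xs⊆xs++ys Γ Γ₀) d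

⊩-numeral-transfer : ExcludedMiddle 0ℓ → ∀ {S φ n m} → ExtendsSucc⁻ S → WF 1 φ →
  rank φ < n → rank φ < m → S ⊩ (φ [ num n ]) → S ⊩ (φ [ num m ])
⊩-numeral-transfer em ext wφ r<n r<m s with ⊩-with-succ ext s
... | Γ , SΓ , ax , d = Γ , SΓ , numeral-transfer em wφ r<n r<m ax d

bounded⇒finite : ExcludedMiddle 0ℓ → ∀ (P : ℕ → Set) B → (∀ n → P n → n < B) → Finite P
bounded⇒finite em P B bound = filter P? (upTo B) , λ n →
  (λ Pn → ∈-filter⁺ P? (∈-upTo⁺ (bound n Pn)) Pn) , (proj₂ ∘ ∈-filter⁻ P? {xs = upTo B})
  where
  P? = λ n → em {P n}

constant-above⇒finite⊎cofinite : ExcludedMiddle 0ℓ → ∀ (X : ℕ → Set) r →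
  (∀ n m → r < n → r < m → X n → X m) → Finite X ⊎ CoFinite X
constant-above⇒finite⊎cofinite em X r constant with em {X (suc r)}
... | yes X-above = inj₂ (bounded⇒finite em (λ n → ¬ X n) (suc r)
        (λ n ¬Xn → s≤s (≮⇒≥ (λ r<n → ¬Xn (constant (suc r) n ≤-refl r<n X-above)))))
... | no ¬X-above = inj₁ (bounded⇒finite em X (suc r)
        (λ n Xn → s≤s (≮⇒≥ (λ r<n → ¬X-above (constant n (suc r) r<n ≤-refl Xn)))))

representable⇒finite⊎cofinite : ExcludedMiddle 0ℓ → ∀ {S} → ExtendsSucc⁻ S → ∀ X →
  WeaklyRepresentable X S → Finite X ⊎ CoFinite X
representable⇒finite⊎cofinite em ext X (φ , wφ , rep) =
  constant-above⇒finite⊎cofinite em X (rank φ)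
    (λ n m r<n r<m Xn → proj₂ (rep m) (⊩-numeral-transfer em ext wφ r<n r<m (proj₁ (rep n) Xn)))

OneOf : Term → List ℕ → Formula
OneOf u []      = ⊥'
OneOf u (k ∷ l) = (u ≐ num k) ∨ OneOf u l

WF-OneOf : ∀ l → WF 1 (OneOf (var 0) l)
WF-OneOf []      = ⊥'
WF-OneOf (k ∷ l) = (var (s≤s z≤n) ≐ WFT-num k) ∨ WF-OneOf l
  where
  WFT-num : ∀ k → WFT 1 (num k)
  WFT-num zero    = 𝟎
  WFT-num (suc k) = 𝐒 (WFT-num k)

OneOf-[] : ∀ u l → OneOf (var 0) l [ u ] ≡ OneOf u l
OneOf-[] u []      = refl
OneOf-[] u (k ∷ l) = cong₂ (λ v χ → (u ≐ v) ∨ χ) (substT-num (single u) k) (OneOf-[] u l)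

⊢-OneOf : ∀ {Γ n l} → n ∈ l → Γ ⊢ OneOf (num n) l
⊢-OneOf (here refl) = ∨I₁ (≐refl _)
⊢-OneOf (there n∈l) = ∨I₂ (⊢-OneOf n∈l)

⊢-¬OneOf : ∀ {Γ n} l → ProvesSucc₁₂ Γ → n ∉ l → Γ ⊢ OneOf (num n) l → Γ ⊢ ⊥'
⊢-¬OneOf []      ax n∉l d = d
⊢-¬OneOf {n = n} (k ∷ l) ax n∉l d = ∨E d
  (⊢-num-distinct (ProvesSucc₁₂-weaken there ax) n k (n∉l ∘ here) (assum (here refl)))
  (⊢-¬OneOf l (ProvesSucc₁₂-weaken there ax) (n∉l ∘ there) (assum (here refl)))

module _ (em : ExcludedMiddle 0ℓ) {S : Theory} (ext : ExtendsSucc⁻ S) (con : Consistent S)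
         (X : ℕ → Set) where

  finite⇒representable : Finite X → WeaklyRepresentable X S
  finite⇒representable (l , X⇔∈l) = OneOf (var 0) l , WF-OneOf l , λ n → represents n , reflects n
    where
    represents : ∀ n → X n → S ⊩ (OneOf (var 0) l [ num n ])
    represents n Xn = [] , [] , ≡.subst ([] ⊢_) (sym (OneOf-[] (num n) l)) (⊢-OneOf (proj₁ (X⇔∈l n) Xn))
    reflects : ∀ n → S ⊩ (OneOf (var 0) l [ num n ]) → X n
    reflects n s with ⊩-with-succ ext s
    ... | Γ , SΓ , ax , d = decidable-stable em λ ¬Xn →
      con (Γ , SΓ , ⊢-¬OneOf l ax (¬Xn ∘ proj₂ (X⇔∈l n)) (≡.subst (Γ ⊢_) (OneOf-[] (num n) l) d))

  cofinite⇒representable : CoFinite X → WeaklyRepresentable X S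
  cofinite⇒representable (l , ¬X⇔∈l) =
    ¬' (OneOf (var 0) l) , (WF-OneOf l ⇒ ⊥') , λ n → represents n , reflects n
    where
    represents : ∀ n → X n → S ⊩ (¬' (OneOf (var 0) l) [ num n ])
    represents n Xn with succ-context ext
    ... | Γ , SΓ , ax = Γ , SΓ , ⇒I (⊢-¬OneOf l (ProvesSucc₁₂-weaken there ax)
      (λ n∈l → proj₂ (¬X⇔∈l n) n∈l Xn)
      (≡.subst (OneOf (var 0) l [ num n ] ∷ Γ ⊢_) (OneOf-[] (num n) l) (assum (here refl))))
    reflects : ∀ n → S ⊩ (¬' (OneOf (var 0) l) [ num n ]) → X n
    reflects n (Γ , SΓ , d) = decidable-stable em λ ¬Xn →
      con (Γ , SΓ , ⇒E d (≡.subst (Γ ⊢_) (sym (OneOf-[] (num n) l)) (⊢-OneOf (proj₁ (¬X⇔∈l n) ¬Xn))))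

theorem4p4 : ExcludedMiddle 0ℓ → (S : Theory) → IsSentenceTheory S →
    ExtendsSucc⁻ S → Consistent S → (X : ℕ → Set) →
    (WeaklyRepresentable X S → Finite X ⊎ CoFinite X) ×
    (Finite X ⊎ CoFinite X → WeaklyRepresentable X S)
-- The argument works for open axioms too.
theorem4p4 em S _ ext con X =
  representable⇒finite⊎cofinite em ext X ,
  λ { (inj₁ finite) → finite⇒representable em ext con X finite
    ; (inj₂ cofinite) → cofinite⇒representable em ext con X cofinite }
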